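{- Let $\rho\ge2$ and $\mu\ge1$ be natural numbers and let $K$ be a quasi-arithmetic compact set of module $\mu$ and ratio $\rho$ (of order type $\omega^\omega+1$ under $\preccurlyeq$), with stability gauge $\Vert\cdot\Vert_K$. Then for every natural number $n$, $\Vert\rho n\Vert_K=\Vert n\Vert_K+\mu$.
   Context: For $A\subset\mathbf{R}$, $A'$ denotes the derived set of $A$, $A^{(0)}=A$, $A^{(n+1)}=(A^{(n)})'$. The order $\preccurlyeq$ is given by $x\preccurlyeq y$ iff $x\ge y$. A compact $K\subset[0,+\infty)$ is a self-similar compact set of ratio $\rho>1$ and module $\mu\in\mathbf{N}$ if $\rho K^{(\mu)}=K$ and $K$ is well ordered by $\preccurlyeq$. Such a $K$ is quasi-arithmetic if $\rho\ge2$ is a natural number and there is $\kappa:\mathbf{N}\setminus\rho\mathbf{N}\to\mathbf{Z}_{\ge0}$ with $K\setminus\{0\}=\{\frac{m}{\rho^k}: \rho\nmid m,\ k\ge\kappa(m)\}$. Put $T_u=K^{(u)}\setminus K^{(u+1)}$ for $u\in\mathbf{Z}_{\ge0}$; these sets are disjoint and cover $K\setminus\{0\}$. For any natural number $n$ there are an integer $\ell$ and $u\ge0$ with $n/\rho^\ell\in T_u$, and the quantity $\ell\mu-u$ does not depend on the choice of such $(\ell,u)$. The stability gauge is $\Vert n\Vert_K=\ell\mu+d-u$ whenever $n/\rho^\ell\in T_u$, where the constant $d$ (displacement) is chosen so that $\Vert 1\Vert_K=0$. -}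

module Defs where

open import Data.Nat as ℕ using (ℕ; zero; suc; _^_)
open import Data.Nat.Divisibility using (_∣_)
open import Data.Integer as ℤ using (ℤ; +_; -[1+_])
open import Data.Rational as ℚ using (ℚ; _/_; 0ℚ; ∣_∣; _-_; _<_; _≤_; _*_)
open import Data.List using (List)
open import Data.List.Membership.Propositional using (_∈_)
open import Data.Product using (Σ; ∃; _×_; Σ-syntax; ∃-syntax)
open import Relation.Nullary using (¬_)
open import Relation.Binary.PropositionalEquality using (_≡_; _≢_)
open import Induction.WellFounded using (WellFounded)

-- Subsets of the reals that turn out to lie in ℚ are represented as predicates on ℚ.
-- (A quasi-arithmetic K satisfies K ⊆ {0} ∪ {m/ρ^k}, hence K ⊆ ℚ.)
Subset : Set₁
Subset = ℚ → Set

ι : ℕ → ℚ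
ι n = + n / 1

-- "x = n / ρ^ℓ" for an integer exponent ℓ (written without division)
IsScaled : (ρ n : ℕ) → ℤ → ℚ → Set
IsScaled ρ n (+ k)     x = x * ι (ρ ^ k) ≡ ι n
IsScaled ρ n -[1+ k ]  x = x ≡ ι (n ℕ.* ρ ^ suc k)

-- derived set: x is a limit point of A (in ℝ; for A ⊆ K with K closed,
-- every real limit point lies in K ⊆ ℚ, so restricting to ℚ is faithful)
Derived : Subset → Subset
Derived A x = ∀ (ε : ℚ) → 0ℚ < ε → ∃[ a ] (A a × a ≢ x × ∣ a - x ∣ < ε)

Deriv : ℕ → Subset → Subset
Deriv zero    A = A
Deriv (suc n) A = Derived (Deriv n A)

IsCauchy : (ℕ → ℚ) → Set
IsCauchy f = ∀ (ε : ℚ) → 0ℚ < ε → ∃[ N ] (∀ i j → N ℕ.≤ i → N ℕ.≤ j → ∣ f i - f j ∣ < ε)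

ConvergesTo : (ℕ → ℚ) → ℚ → Set
ConvergesTo f L = ∀ (ε : ℚ) → 0ℚ < ε → ∃[ N ] (∀ i → N ℕ.≤ i → ∣ f i - L ∣ < ε)

Complete : Subset → Set
Complete K = ∀ (f : ℕ → ℚ) → (∀ i → K (f i)) → IsCauchy f → ∃[ L ] (K L × ConvergesTo f L)

TotallyBounded : Subset → Set
TotallyBounded K = ∀ (ε : ℚ) → 0ℚ < ε →
  Σ[ c ∈ List ℚ ] ((∀ y → y ∈ c → K y) × (∀ x → K x → ∃[ y ] (y ∈ c × ∣ x - y ∣ < ε)))

Compact : Subset → Set
Compact K = Complete K × TotallyBounded K

-- strict part of x ≼ y :⇔ x ≥ y, restricted to K
StrictPrec : Subset → ℚ → ℚ → Set
StrictPrec K x y = K x × K y × y < x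

-- K well ordered by ≼ (≼ is a total order; well-ordered = well-founded strict part)
WellOrderedPrec : Subset → Set
WellOrderedPrec K = WellFounded (StrictPrec K)

SelfSimilar : (ρ μ : ℕ) → Subset → Set
SelfSimilar ρ μ K =
  Compact K × (∀ x → K x → 0ℚ ≤ x) ×
  (∀ x → (K x → ∃[ y ] (Deriv μ K y × x ≡ ι ρ * y)) × (∃[ y ] (Deriv μ K y × x ≡ ι ρ * y) → K x)) ×
  WellOrderedPrec K

-- quasi-arithmetic: K \ {0} = { m/ρ^k : ρ ∤ m, k ≥ κ(m) }
-- (κ is only ever evaluated on m with ρ ∤ m)
QuasiArithmetic : (ρ μ : ℕ) → Subset → Set
QuasiArithmetic ρ μ K =
  SelfSimilar ρ μ K × 2 ℕ.≤ ρ ×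
  Σ[ κ ∈ (ℕ → ℕ) ] (∀ x → x ≢ 0ℚ →
     (K x → ∃[ m ] ∃[ k ] (¬ (ρ ∣ m) × κ m ℕ.≤ k × IsScaled ρ m (+ k) x)) ×
     (∃[ m ] ∃[ k ] (¬ (ρ ∣ m) × κ m ℕ.≤ k × IsScaled ρ m (+ k) x) → K x))

T : Subset → ℕ → Subset
T K u x = Deriv u K x × ¬ Deriv (suc u) K x

-- g is the stability gauge ‖n‖_K:  g = ℓμ + d - u with n/ρ^ℓ ∈ T_u, where the
-- displacement d = u₁ - ℓ₁μ is determined by 1/ρ^ℓ₁ ∈ T_u₁ (so that ‖1‖_K = 0).
IsGauge : (ρ μ : ℕ) → Subset → ℕ → ℤ → Set
IsGauge ρ μ K n g =
  Σ[ ℓ ∈ ℤ ] Σ[ u ∈ ℕ ] Σ[ ℓ₁ ∈ ℤ ] Σ[ u₁ ∈ ℕ ]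
    ((∃[ x ] (IsScaled ρ n ℓ x × T K u x)) ×
     (∃[ x ] (IsScaled ρ 1 ℓ₁ x × T K u₁ x)) ×
     g ≡ ℓ ℤ.* (+ μ) ℤ.+ ((+ u₁) ℤ.- ℓ₁ ℤ.* (+ μ)) ℤ.- (+ u))

-- Multiplication by ρ is a homeomorphism of ℚ, so it commutes with taking derived sets;
-- together with ρ K^(μ) = K this gives ρ K^(j+μ) = K^(j), i.e. x ∈ T_(u+μ) iff ρx ∈ T_u.
-- Consequently ℓμ − u does not depend on the representation n/ρ^ℓ ∈ T_u, and since
-- ρn/ρ^(ℓ+1) = n/ρ^ℓ lies in the same T_u, the gauge of ρn exceeds that of n by μ.
module Submission where

open import Defs
open import Data.Nat using (ℕ; _≤_; _*_)
open import Data.Integer using (ℤ; +_; _+_)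
open import Relation.Binary.PropositionalEquality using (_≡_)

open import Algebra.Bundles using (CommutativeMonoid)
import Algebra.Properties.CommutativeSemigroup as CommutativeSemigroupProperties
import Algebra.Properties.Group as GroupProperties
open import Data.Empty using (⊥-elim)
open import Data.Nat as ℕ using (zero; suc; _^_; _≤′_; ≤′-refl; ≤′-step)
import Data.Nat.Coprimality as Coprimality
import Data.Nat.Properties as ℕP
import Data.Integer as ℤ
open import Data.Integer using (-[1+_])
import Data.Integer.Properties as ℤP
import Data.Integer.Tactic.RingSolver as ℤ-Solver
open import Data.Rational using (ℚ; 0ℚ; 1ℚ; Positive; NonNegative; NonZero)
import Data.Rational as ℚ
import Data.Rational.Properties as ℚP
import Data.Rational.Unnormalised as ℚᵘ
import Data.Rational.Unnormalised.Properties as ℚᵘP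
open import Data.Product using (_,_; proj₁; proj₂; ∃-syntax; _×_)
open import Data.Sum using (inj₁; inj₂)
open import Function using (_∘_; id; _⇔_; mk⇔; Equivalence)
open import Level using (0ℓ)
open import Relation.Binary.Definitions using (tri<; tri≈; tri>)
open import Relation.Binary.PropositionalEquality
  using (_≢_; refl; sym; trans; cong; cong₂; subst; subst₂; module ≡-Reasoning)
open import Relation.Nullary.Decidable using (dec⇒maybe)
open import Relation.Unary using (_⊆_)
open import Tactic.RingSolver using (solve-∀)
open import Tactic.RingSolver.Core.AlmostCommutativeRing using (AlmostCommutativeRing; fromCommutativeRing)

open Equivalence using (to; from)

module ℕ-* = CommutativeSemigroupProperties ℕP.*-commutativeSemigroup
module ℚ-* = CommutativeSemigroupProperties (CommutativeMonoid.commutativeSemigroup ℚP.*-1-commutativeMonoid)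

ℚ-ring : AlmostCommutativeRing 0ℓ 0ℓ
ℚ-ring = fromCommutativeRing ℚP.+-*-commutativeRing (λ p → dec⇒maybe (0ℚ ℚP.≟ p))

mkℚ-ℕ : ℕ → ℚ
mkℚ-ℕ n = ℚ.mkℚ (+ n) 0 (Coprimality.sym (Coprimality.1-coprimeTo n))

ι-mkℚ : ∀ n → ι n ≡ mkℚ-ℕ n
ι-mkℚ n = ℚP.normalize-coprime _

ι-1 : ι 1 ≡ 1ℚ
ι-1 = ι-mkℚ 1

ι-* : ∀ m n → ι (m * n) ≡ ι m ℚ.* ι n
ι-* m n rewrite ι-mkℚ m | ι-mkℚ n | ι-mkℚ (m * n) =
  ℚP.toℚᵘ-injective (ℚᵘP.≃-trans (ℚᵘ.*≡* (cong (ℤ._* + 1) (ℤP.pos-* m n))) (ℚᵘP.≃-sym (ℚP.toℚᵘ-homo-* (mkℚ-ℕ m) (mkℚ-ℕ n))))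

ι-positive : ∀ n .{{_ : ℕ.NonZero n}} → Positive (ι n)
ι-positive n = ℚP.normalize-pos n 1

ι1*p≡p : ∀ p → ι 1 ℚ.* p ≡ p
ι1*p≡p p = trans (cong (ℚ._* p) ι-1) (ℚP.*-identityˡ p)

1/c*[c*p]≡p : ∀ c .{{_ : NonZero c}} p → ℚ.1/ c ℚ.* (c ℚ.* p) ≡ p
1/c*[c*p]≡p c p = begin
  ℚ.1/ c ℚ.* (c ℚ.* p)  ≡⟨ ℚP.*-assoc (ℚ.1/ c) c p ⟨
  ℚ.1/ c ℚ.* c ℚ.* p    ≡⟨ cong (ℚ._* p) (ℚP.*-inverseˡ c) ⟩
  1ℚ ℚ.* p              ≡⟨ ℚP.*-identityˡ p ⟩
  p                     ∎
  where open ≡-Reasoning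

c*[1/c*p]≡p : ∀ c .{{_ : NonZero c}} p → c ℚ.* (ℚ.1/ c ℚ.* p) ≡ p
c*[1/c*p]≡p c p = begin
  c ℚ.* (ℚ.1/ c ℚ.* p)  ≡⟨ ℚP.*-assoc c (ℚ.1/ c) p ⟨
  c ℚ.* ℚ.1/ c ℚ.* p    ≡⟨ cong (ℚ._* p) (ℚP.*-inverseʳ c) ⟩
  1ℚ ℚ.* p              ≡⟨ ℚP.*-identityˡ p ⟩
  p                     ∎
  where open ≡-Reasoning

*-cancelˡ-≡ : ∀ c .{{_ : NonZero c}} {p q} → c ℚ.* p ≡ c ℚ.* q → p ≡ q
*-cancelˡ-≡ c {p} {q} cp≡cq = begin
  p                      ≡⟨ 1/c*[c*p]≡p c p ⟨
  ℚ.1/ c ℚ.* (c ℚ.* p)   ≡⟨ cong (ℚ.1/ c ℚ.*_) cp≡cq ⟩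
  ℚ.1/ c ℚ.* (c ℚ.* q)   ≡⟨ 1/c*[c*p]≡p c q ⟩
  q                      ∎
  where open ≡-Reasoning

*-cancelʳ-≡ : ∀ c .{{_ : NonZero c}} {p q} → p ℚ.* c ≡ q ℚ.* c → p ≡ q
*-cancelʳ-≡ c {p} {q} pc≡qc = *-cancelˡ-≡ c (trans (ℚP.*-comm c p) (trans pc≡qc (ℚP.*-comm q c)))

*-pres-0< : ∀ c .{{_ : Positive c}} {p} → 0ℚ ℚ.< p → 0ℚ ℚ.< c ℚ.* p
*-pres-0< c {p} 0<p = ℚP.positive⁻¹ (c ℚ.* p) {{ℚP.pos*pos⇒pos c p {{ℚ.positive 0<p}}}}

⊓-pres-0< : ∀ {p q} → 0ℚ ℚ.< p → 0ℚ ℚ.< q → 0ℚ ℚ.< p ℚ.⊓ q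
⊓-pres-0< {p} {q} 0<p 0<q with ℚP.⊓-sel p q
... | inj₁ p⊓q≡p = subst (0ℚ ℚ.<_) (sym p⊓q≡p) 0<p
... | inj₂ p⊓q≡q = subst (0ℚ ℚ.<_) (sym p⊓q≡q) 0<q

p<q⇒0<q-p : ∀ {p q} → p ℚ.< q → 0ℚ ℚ.< q ℚ.- p
p<q⇒0<q-p {p} {q} p<q = subst (ℚ._< q ℚ.- p) (ℚP.+-inverseʳ p) (ℚP.+-monoˡ-< (ℚ.- p) p<q)

0<∣p-q∣ : ∀ {p q} → p ≢ q → 0ℚ ℚ.< ℚ.∣ p ℚ.- q ∣
0<∣p-q∣ {p} {q} p≢q with ℚP.<-cmp 0ℚ ℚ.∣ p ℚ.- q ∣
... | tri< 0<∣p-q∣ _ _ = 0<∣p-q∣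
... | tri≈ _ 0≡∣p-q∣ _ =
  ⊥-elim (p≢q (GroupProperties.x∙y⁻¹≈ε⇒x≈y ℚP.+-0-group p q (ℚP.∣p∣≡0⇒p≡0 _ (sym 0≡∣p-q∣))))
... | tri> _ _ ∣p-q∣<0 = ⊥-elim (ℚP.<-irrefl refl (ℚP.<-≤-trans ∣p-q∣<0 (ℚP.0≤∣p∣ _)))

∣p-q∣≡∣q-p∣ : ∀ p q → ℚ.∣ p ℚ.- q ∣ ≡ ℚ.∣ q ℚ.- p ∣
∣p-q∣≡∣q-p∣ p q = trans (cong ℚ.∣_∣ (p-q≡-[q-p] p q)) (ℚP.∣-p∣≡∣p∣ (q ℚ.- p))
  where
  p-q≡-[q-p] : ∀ p q → p ℚ.- q ≡ ℚ.- (q ℚ.- p)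
  p-q≡-[q-p] = solve-∀ ℚ-ring

∣p-r∣≤∣p-q∣+∣q-r∣ : ∀ p q r → ℚ.∣ p ℚ.- r ∣ ℚ.≤ ℚ.∣ p ℚ.- q ∣ ℚ.+ ℚ.∣ q ℚ.- r ∣
∣p-r∣≤∣p-q∣+∣q-r∣ p q r =
  subst (ℚ._≤ ℚ.∣ p ℚ.- q ∣ ℚ.+ ℚ.∣ q ℚ.- r ∣) (cong ℚ.∣_∣ (p-q+[q-r]≡p-r p q r)) (ℚP.∣p+q∣≤∣p∣+∣q∣ (p ℚ.- q) (q ℚ.- r))
  where
  p-q+[q-r]≡p-r : ∀ p q r → (p ℚ.- q) ℚ.+ (q ℚ.- r) ≡ p ℚ.- r
  p-q+[q-r]≡p-r = solve-∀ ℚ-ring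

∣c*p-c*q∣≡c*∣p-q∣ : ∀ c .{{_ : NonNegative c}} p q → ℚ.∣ c ℚ.* p ℚ.- c ℚ.* q ∣ ≡ c ℚ.* ℚ.∣ p ℚ.- q ∣
∣c*p-c*q∣≡c*∣p-q∣ c p q = begin
  ℚ.∣ c ℚ.* p ℚ.- c ℚ.* q ∣    ≡⟨ cong ℚ.∣_∣ (c*p-c*q≡c*[p-q] c p q) ⟩
  ℚ.∣ c ℚ.* (p ℚ.- q) ∣        ≡⟨ ℚP.∣p*q∣≡∣p∣*∣q∣ c (p ℚ.- q) ⟩
  ℚ.∣ c ∣ ℚ.* ℚ.∣ p ℚ.- q ∣    ≡⟨ cong (ℚ._* ℚ.∣ p ℚ.- q ∣) (ℚP.0≤p⇒∣p∣≡p (ℚP.nonNegative⁻¹ c)) ⟩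
  c ℚ.* ℚ.∣ p ℚ.- q ∣          ∎
  where
  open ≡-Reasoning
  c*p-c*q≡c*[p-q] : ∀ c p q → c ℚ.* p ℚ.- c ℚ.* q ≡ c ℚ.* (p ℚ.- q)
  c*p-c*q≡c*[p-q] = solve-∀ ℚ-ring

module _ (ρ : ℕ) where

  IsScaled-ρ* : ∀ n ℓ {x} → IsScaled ρ n ℓ x → IsScaled ρ (ρ * n) (ℓ + + 1) x
  IsScaled-ρ* n (+ a) {x} x*ρᵃ≡n = begin
    x ℚ.* ι (ρ ^ (a ℕ.+ 1))      ≡⟨ cong (λ k → x ℚ.* ι (ρ ^ k)) (ℕP.+-comm a 1) ⟩
    x ℚ.* ι (ρ * ρ ^ a)          ≡⟨ cong (x ℚ.*_) (ι-* ρ (ρ ^ a)) ⟩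
    x ℚ.* (ι ρ ℚ.* ι (ρ ^ a))    ≡⟨ ℚ-*.x∙yz≈y∙xz x (ι ρ) (ι (ρ ^ a)) ⟩
    ι ρ ℚ.* (x ℚ.* ι (ρ ^ a))    ≡⟨ cong (ι ρ ℚ.*_) x*ρᵃ≡n ⟩
    ι ρ ℚ.* ι n                  ≡⟨ ι-* ρ n ⟨
    ι (ρ * n)                    ∎
    where open ≡-Reasoning
  IsScaled-ρ* n -[1+ 0 ] {x} x≡n*ρ = begin
    x ℚ.* ι 1          ≡⟨ ℚP.*-comm x (ι 1) ⟩
    ι 1 ℚ.* x          ≡⟨ ι1*p≡p x ⟩
    x                  ≡⟨ x≡n*ρ ⟩
    ι (n * (ρ * 1))    ≡⟨ cong (λ r → ι (n * r)) (ℕP.*-identityʳ ρ) ⟩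
    ι (n * ρ)          ≡⟨ cong ι (ℕP.*-comm n ρ) ⟩
    ι (ρ * n)          ∎
    where open ≡-Reasoning
  IsScaled-ρ* n -[1+ suc a ] x≡n*ρᵃ⁺² = trans x≡n*ρᵃ⁺² (cong ι (ℕ-*.x∙yz≈yx∙z n ρ (ρ ^ suc a)))

  IsScaled-step : ∀ m ℓ {x} → IsScaled ρ m (ℓ + + 1) x → IsScaled ρ m ℓ (ι ρ ℚ.* x)
  IsScaled-step m (+ a) {x} x*ρᵃ⁺¹≡m = begin
    ι ρ ℚ.* x ℚ.* ι (ρ ^ a)      ≡⟨ ℚ-*.xy∙z≈y∙xz (ι ρ) x (ι (ρ ^ a)) ⟩
    x ℚ.* (ι ρ ℚ.* ι (ρ ^ a))    ≡⟨ cong (x ℚ.*_) (ι-* ρ (ρ ^ a)) ⟨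
    x ℚ.* ι (ρ * ρ ^ a)          ≡⟨ cong (λ k → x ℚ.* ι (ρ ^ k)) (ℕP.+-comm 1 a) ⟩
    x ℚ.* ι (ρ ^ (a ℕ.+ 1))      ≡⟨ x*ρᵃ⁺¹≡m ⟩
    ι m                          ∎
    where open ≡-Reasoning
  IsScaled-step m -[1+ 0 ] {x} x*1≡m = begin
    ι ρ ℚ.* x          ≡⟨ cong (ι ρ ℚ.*_) (trans (sym (ι1*p≡p x)) (trans (ℚP.*-comm (ι 1) x) x*1≡m)) ⟩
    ι ρ ℚ.* ι m        ≡⟨ ι-* ρ m ⟨
    ι (ρ * m)          ≡⟨ cong ι (ℕP.*-comm ρ m) ⟩
    ι (m * ρ)          ≡⟨ cong (λ r → ι (m * r)) (ℕP.*-identityʳ ρ) ⟨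
    ι (m * (ρ * 1))    ∎
    where open ≡-Reasoning
  IsScaled-step m -[1+ suc a ] {x} x≡m*ρᵃ⁺¹ = begin
    ι ρ ℚ.* x                        ≡⟨ cong (ι ρ ℚ.*_) x≡m*ρᵃ⁺¹ ⟩
    ι ρ ℚ.* ι (m * ρ ^ suc a)        ≡⟨ ι-* ρ (m * ρ ^ suc a) ⟨
    ι (ρ * (m * ρ ^ suc a))          ≡⟨ cong ι (ℕ-*.x∙yz≈y∙xz ρ m (ρ ^ suc a)) ⟩
    ι (m * ρ ^ suc (suc a))          ∎
    where open ≡-Reasoning

  IsScaled-shift : ∀ m ℓ k {x} → IsScaled ρ m (ℓ + + k) x → IsScaled ρ m ℓ (ι (ρ ^ k) ℚ.* x)
  IsScaled-shift m ℓ zero {x} x≈m/ρˡ =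
    subst₂ (IsScaled ρ m) (ℤP.+-identityʳ ℓ) (sym (ι1*p≡p x)) x≈m/ρˡ
  IsScaled-shift m ℓ (suc k) {x} x≈m/ρˡ⁺ᵏ⁺¹ =
    subst (IsScaled ρ m ℓ) ρᵏ[ρx]≡ρᵏ⁺¹x
      (IsScaled-shift m ℓ k (IsScaled-step m (ℓ + + k) (subst (λ l → IsScaled ρ m l x) ℓ+[k+1]≡[ℓ+k]+1 x≈m/ρˡ⁺ᵏ⁺¹)))
    where
    ℓ+[k+1]≡[ℓ+k]+1 : ℓ + + suc k ≡ (ℓ + + k) + + 1
    ℓ+[k+1]≡[ℓ+k]+1 = trans (cong (λ t → ℓ + + t) (ℕP.+-comm 1 k)) (sym (ℤP.+-assoc ℓ (+ k) (+ 1)))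
    ρᵏ[ρx]≡ρᵏ⁺¹x : ι (ρ ^ k) ℚ.* (ι ρ ℚ.* x) ≡ ι (ρ ^ suc k) ℚ.* x
    ρᵏ[ρx]≡ρᵏ⁺¹x = trans (ℚ-*.x∙yz≈yx∙z (ι (ρ ^ k)) (ι ρ) x) (cong (ℚ._* x) (sym (ι-* ρ (ρ ^ k))))

  IsScaled-unique : .{{_ : ℕ.NonZero ρ}} → ∀ m ℓ {x y} → IsScaled ρ m ℓ x → IsScaled ρ m ℓ y → x ≡ y
  IsScaled-unique m (+ a) x*ρᵃ≡m y*ρᵃ≡m =
    *-cancelʳ-≡ (ι (ρ ^ a)) {{ℚP.pos⇒nonZero (ι (ρ ^ a)) {{ι-positive (ρ ^ a) {{ℕP.m^n≢0 ρ a}}}}}} (trans x*ρᵃ≡m (sym y*ρᵃ≡m))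
  IsScaled-unique m -[1+ a ] x≡mρᵃ⁺¹ y≡mρᵃ⁺¹ = trans x≡mρᵃ⁺¹ (sym y≡mρᵃ⁺¹)

Derived-mono : ∀ {A B : Subset} → A ⊆ B → Derived A ⊆ Derived B
Derived-mono A⊆B x∈A′ ε 0<ε =
  let a , a∈A , a≢x , a-close = x∈A′ ε 0<ε in a , A⊆B a∈A , a≢x , a-close

Derived-Derived⊆Derived : ∀ {A : Subset} → Derived (Derived A) ⊆ Derived A
Derived-Derived⊆Derived {A} {x} x∈A″ ε 0<ε with x∈A″ ε 0<ε
... | a , a∈A′ , a≢x , ∣a-x∣<ε with a∈A′ (d ℚ.⊓ (ε ℚ.- d)) (⊓-pres-0< (0<∣p-q∣ a≢x) (p<q⇒0<q-p ∣a-x∣<ε))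
  where d = ℚ.∣ a ℚ.- x ∣
... | b , b∈A , _ , ∣b-a∣<δ = b , b∈A , b≢x , ∣b-x∣<ε
  where
  open ℚP.≤-Reasoning
  d = ℚ.∣ a ℚ.- x ∣
  b≢x : b ≢ x
  b≢x refl = ℚP.<-irrefl (∣p-q∣≡∣q-p∣ b a) (ℚP.<-≤-trans ∣b-a∣<δ (ℚP.p⊓q≤p d (ε ℚ.- d)))
  ∣b-x∣<ε : ℚ.∣ b ℚ.- x ∣ ℚ.< ε
  ∣b-x∣<ε = begin-strict
    ℚ.∣ b ℚ.- x ∣                 ≤⟨ ∣p-r∣≤∣p-q∣+∣q-r∣ b a x ⟩
    ℚ.∣ b ℚ.- a ∣ ℚ.+ d           <⟨ ℚP.+-monoˡ-< d (ℚP.<-≤-trans ∣b-a∣<δ (ℚP.p⊓q≤q d (ε ℚ.- d))) ⟩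
    (ε ℚ.- d) ℚ.+ d               ≡⟨ ε-d+d≡ε ε d ⟩
    ε                             ∎
    where
    ε-d+d≡ε : ∀ ε d → (ε ℚ.- d) ℚ.+ d ≡ ε
    ε-d+d≡ε = solve-∀ ℚ-ring

-- A′ ⊆ A fails in general, hence the successors.
Deriv-antitone : ∀ {A : Subset} {m n} → m ≤ n → Deriv (suc n) A ⊆ Deriv (suc m) A
Deriv-antitone m≤n = antitone′ (ℕP.≤⇒≤′ m≤n)
  where
  Deriv-suc⊆ : ∀ {A} n → Deriv (suc (suc n)) A ⊆ Deriv (suc n) A
  Deriv-suc⊆ zero = Derived-Derived⊆Derived
  Deriv-suc⊆ (suc n) = Derived-mono (Deriv-suc⊆ n)
  antitone′ : ∀ {A m n} → m ≤′ n → Deriv (suc n) A ⊆ Deriv (suc m) A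
  antitone′ ≤′-refl = id
  antitone′ (≤′-step {n} m≤′n) = antitone′ m≤′n ∘ Deriv-suc⊆ n

T-unique : ∀ {K : Subset} {u v x} → T K u x → T K v x → u ≡ v
T-unique {u = u} {v} (x∈K⁽ᵘ⁾ , x∉K⁽ᵘ⁺¹⁾) (x∈K⁽ᵛ⁾ , x∉K⁽ᵛ⁺¹⁾) with ℕP.<-cmp u v
... | tri< (ℕ.s≤s u≤v′) _ _ = ⊥-elim (x∉K⁽ᵘ⁺¹⁾ (Deriv-antitone u≤v′ x∈K⁽ᵛ⁾))
... | tri≈ _ u≡v _ = u≡v
... | tri> _ _ (ℕ.s≤s v≤u′) = ⊥-elim (x∉K⁽ᵛ⁺¹⁾ (Deriv-antitone v≤u′ x∈K⁽ᵘ⁾))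

module _ (c : ℚ) .{{_ : Positive c}} where
  private instance
    c≢0 : NonZero c
    c≢0 = ℚP.pos⇒nonZero c
    c≥0 : NonNegative c
    c≥0 = ℚP.pos⇒nonNeg c
    1/c>0 : Positive (ℚ.1/ c)
    1/c>0 = ℚP.1/pos⇒pos c

  Derived-∘-scale : ∀ {A : Subset} {z} → Derived (A ∘ (c ℚ.*_)) z → Derived A (c ℚ.* z)
  Derived-∘-scale {A} {z} z∈[A∘c]′ ε 0<ε with z∈[A∘c]′ (ℚ.1/ c ℚ.* ε) (*-pres-0< (ℚ.1/ c) 0<ε)
  ... | y , cy∈A , y≢z , ∣y-z∣<ε/c = c ℚ.* y , cy∈A , y≢z ∘ *-cancelˡ-≡ c , ∣cy-cz∣<ε
    where
    open ℚP.≤-Reasoning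
    ∣cy-cz∣<ε : ℚ.∣ c ℚ.* y ℚ.- c ℚ.* z ∣ ℚ.< ε
    ∣cy-cz∣<ε = begin-strict
      ℚ.∣ c ℚ.* y ℚ.- c ℚ.* z ∣   ≡⟨ ∣c*p-c*q∣≡c*∣p-q∣ c y z ⟩
      c ℚ.* ℚ.∣ y ℚ.- z ∣         <⟨ ℚP.*-monoʳ-<-pos c ∣y-z∣<ε/c ⟩
      c ℚ.* (ℚ.1/ c ℚ.* ε)        ≡⟨ c*[1/c*p]≡p c ε ⟩
      ε                           ∎

  Derived-∘-scale⁻ : ∀ {A : Subset} {z} → Derived A (c ℚ.* z) → Derived (A ∘ (c ℚ.*_)) z
  Derived-∘-scale⁻ {A} {z} cz∈A′ ε 0<ε with cz∈A′ (c ℚ.* ε) (*-pres-0< c 0<ε)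
  ... | a , a∈A , a≢cz , ∣a-cz∣<cε = y , subst A (sym (c*[1/c*p]≡p c a)) a∈A , y≢z , ∣y-z∣<ε
    where
    open ℚP.≤-Reasoning
    y = ℚ.1/ c ℚ.* a
    y≢z : y ≢ z
    y≢z y≡z = a≢cz (trans (sym (c*[1/c*p]≡p c a)) (cong (c ℚ.*_) y≡z))
    ∣y-z∣<ε : ℚ.∣ y ℚ.- z ∣ ℚ.< ε
    ∣y-z∣<ε = ℚP.*-cancelˡ-<-nonNeg c (begin-strict
      c ℚ.* ℚ.∣ y ℚ.- z ∣         ≡⟨ ∣c*p-c*q∣≡c*∣p-q∣ c y z ⟨
      ℚ.∣ c ℚ.* y ℚ.- c ℚ.* z ∣   ≡⟨ cong (λ b → ℚ.∣ b ℚ.- c ℚ.* z ∣) (c*[1/c*p]≡p c a) ⟩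
      ℚ.∣ a ℚ.- c ℚ.* z ∣         <⟨ ∣a-cz∣<cε ⟩
      c ℚ.* ε                     ∎)

InT : (ρ : ℕ) → Subset → ℕ → ℤ → ℕ → Set
InT ρ K n ℓ u = ∃[ x ] (IsScaled ρ n ℓ x × T K u x)

InT-ρ* : ∀ {ρ K n ℓ u} → InT ρ K n ℓ u → InT ρ K (ρ * n) (ℓ + + 1) u
InT-ρ* {ρ} {n = n} {ℓ} (x , x≈n/ρˡ , x∈Tᵤ) = x , IsScaled-ρ* ρ n ℓ x≈n/ρˡ , x∈Tᵤ

≤⇒≡+ : ∀ {i j} → i ℤ.≤ j → ∃[ k ] (j ≡ i + + k)
≤⇒≡+ {i} {j} i≤j = ℤ.∣ j ℤ.- i ∣ , (begin
  j                        ≡⟨ j≡i+[j-i] i j ⟩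
  i + (j ℤ.- i)          ≡⟨ cong (λ t → i + t) (ℤP.0≤i⇒+∣i∣≡i (ℤP.i≤j⇒0≤j-i i≤j)) ⟨
  i + + ℤ.∣ j ℤ.- i ∣    ∎)
  where
  open ≡-Reasoning
  j≡i+[j-i] : ∀ i j → j ≡ i + (j ℤ.- i)
  j≡i+[j-i] = ℤ-Solver.solve-∀

module SelfSimilarSet (ρ μ : ℕ) {{_ : ℕ.NonZero ρ}} (K : Subset) (self-similar : SelfSimilar ρ μ K) where
  private instance
    ρ>0 : Positive (ι ρ)
    ρ>0 = ι-positive ρ
    ρ≢0 : NonZero (ι ρ)
    ρ≢0 = ℚP.pos⇒nonZero (ι ρ)

  K-scale : ∀ {y} → K (ι ρ ℚ.* y) ⇔ Deriv μ K y
  K-scale {y} = mk⇔ ρy∈K⇒y∈K⁽μ⁾ (λ y∈K⁽μ⁾ → proj₂ (ρK⁽μ⁾≡K (ι ρ ℚ.* y)) (y , y∈K⁽μ⁾ , refl))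
    where
    ρK⁽μ⁾≡K = proj₁ (proj₂ (proj₂ self-similar))
    ρy∈K⇒y∈K⁽μ⁾ : K (ι ρ ℚ.* y) → Deriv μ K y
    ρy∈K⇒y∈K⁽μ⁾ ρy∈K with proj₁ (ρK⁽μ⁾≡K (ι ρ ℚ.* y)) ρy∈K
    ... | y′ , y′∈K⁽μ⁾ , ρy≡ρy′ = subst (Deriv μ K) (sym (*-cancelˡ-≡ (ι ρ) ρy≡ρy′)) y′∈K⁽μ⁾

  Deriv-scale : ∀ j {y} → Deriv j K (ι ρ ℚ.* y) ⇔ Deriv (j ℕ.+ μ) K y
  Deriv-scale zero = K-scale
  Deriv-scale (suc j) = mk⇔
    (λ ρy∈K⁽ʲ⁺¹⁾ → Derived-mono (to (Deriv-scale j)) (Derived-∘-scale⁻ (ι ρ) ρy∈K⁽ʲ⁺¹⁾))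
    (λ y∈K⁽ʲ⁺μ⁺¹⁾ → Derived-∘-scale (ι ρ) (Derived-mono (from (Deriv-scale j)) y∈K⁽ʲ⁺μ⁺¹⁾))

  T-scale : ∀ {u y} → T K u (ι ρ ℚ.* y) → T K (u ℕ.+ μ) y
  T-scale {u} (ρy∈K⁽ᵘ⁾ , ρy∉K⁽ᵘ⁺¹⁾) = to (Deriv-scale u) ρy∈K⁽ᵘ⁾ , ρy∉K⁽ᵘ⁺¹⁾ ∘ from (Deriv-scale (suc u))

  T-scale-^ : ∀ k {u y} → T K u (ι (ρ ^ k) ℚ.* y) → T K (u ℕ.+ k * μ) y
  T-scale-^ zero {u} {y} y∈Tᵤ = subst₂ (T K) (sym (ℕP.+-identityʳ u)) (ι1*p≡p y) y∈Tᵤ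
  T-scale-^ (suc k) {u} {y} ρᵏ⁺¹y∈Tᵤ =
    subst (λ v → T K v y) (ℕP.+-assoc u μ (k * μ))
      (T-scale-^ k {u ℕ.+ μ} (T-scale {u} (subst (T K u) ρᵏ⁺¹y≡ρ[ρᵏy] ρᵏ⁺¹y∈Tᵤ)))
    where
    ρᵏ⁺¹y≡ρ[ρᵏy] : ι (ρ ^ suc k) ℚ.* y ≡ ι ρ ℚ.* (ι (ρ ^ k) ℚ.* y)
    ρᵏ⁺¹y≡ρ[ρᵏy] = trans (cong (ℚ._* y) (ι-* ρ (ρ ^ k))) (ℚP.*-assoc (ι ρ) (ι (ρ ^ k)) y)

  InT-shift : ∀ {n ℓ u u′} k → InT ρ K n ℓ u → InT ρ K n (ℓ + + k) u′ → u′ ≡ u ℕ.+ k * μ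
  InT-shift {n} {ℓ} {u} {u′} k (x , x≈n/ρˡ , x∈Tᵤ) (x′ , x′≈n/ρˡ⁺ᵏ , x′∈Tᵤ′) =
    T-unique {u = u′} x′∈Tᵤ′ (T-scale-^ k {u} (subst (T K u) x≡ρᵏx′ x∈Tᵤ))
    where
    x≡ρᵏx′ : x ≡ ι (ρ ^ k) ℚ.* x′
    x≡ρᵏx′ = IsScaled-unique ρ n ℓ x≈n/ρˡ (IsScaled-shift ρ n ℓ k x′≈n/ρˡ⁺ᵏ)

  weight : ℤ → ℕ → ℤ
  weight ℓ u = ℓ ℤ.* + μ ℤ.- + u

  weight-shift : ∀ ℓ k u → weight ℓ u ≡ weight (ℓ + + k) (u ℕ.+ k * μ)
  weight-shift ℓ k u = begin
    ℓ ℤ.* + μ ℤ.- + u                                   ≡⟨ shift ℓ (+ k) (+ u) (+ μ) ⟩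
    (ℓ + + k) ℤ.* + μ ℤ.- (+ u + + k ℤ.* + μ)        ≡⟨ cong (λ t → (ℓ + + k) ℤ.* + μ ℤ.- (+ u + t)) (ℤP.pos-* k μ) ⟨
    (ℓ + + k) ℤ.* + μ ℤ.- (+ u + + (k * μ))          ≡⟨ cong (λ t → (ℓ + + k) ℤ.* + μ ℤ.- t) (ℤP.pos-+ u (k * μ)) ⟨
    (ℓ + + k) ℤ.* + μ ℤ.- + (u ℕ.+ k * μ)             ∎
    where
    open ≡-Reasoning
    shift : ∀ l k u m → l ℤ.* m ℤ.- u ≡ (l + k) ℤ.* m ℤ.- (u + k ℤ.* m)
    shift = ℤ-Solver.solve-∀

  weight-invariant-≤ : ∀ {n ℓ u ℓ′ u′} → ℓ ℤ.≤ ℓ′ → InT ρ K n ℓ u → InT ρ K n ℓ′ u′ → weight ℓ u ≡ weight ℓ′ u′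
  weight-invariant-≤ {ℓ = ℓ} {u} ℓ≤ℓ′ n/ρˡ∈Tᵤ n/ρˡ′∈Tᵤ′ with ≤⇒≡+ ℓ≤ℓ′
  ... | k , refl = trans (weight-shift ℓ k u) (cong (weight (ℓ + + k)) (sym (InT-shift k n/ρˡ∈Tᵤ n/ρˡ′∈Tᵤ′)))

  weight-invariant : ∀ {n ℓ u ℓ′ u′} → InT ρ K n ℓ u → InT ρ K n ℓ′ u′ → weight ℓ u ≡ weight ℓ′ u′
  weight-invariant {ℓ = ℓ} {ℓ′ = ℓ′} n/ρˡ∈Tᵤ n/ρˡ′∈Tᵤ′ with ℤP.≤-total ℓ ℓ′
  ... | inj₁ ℓ≤ℓ′ = weight-invariant-≤ ℓ≤ℓ′ n/ρˡ∈Tᵤ n/ρˡ′∈Tᵤ′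
  ... | inj₂ ℓ′≤ℓ = sym (weight-invariant-≤ ℓ′≤ℓ n/ρˡ′∈Tᵤ′ n/ρˡ∈Tᵤ)

mainTheorem6 : (ρ μ : ℕ) → 2 ≤ ρ → 1 ≤ μ → (K : Subset) → QuasiArithmetic ρ μ K →
    (n : ℕ) → 1 ≤ n → (g g′ : ℤ) → IsGauge ρ μ K n g → IsGauge ρ μ K (ρ * n) g′ →
    g′ ≡ g + (+ μ)
mainTheorem6 ρ μ 2≤ρ _ K (self-similar , _) n _ g g′
  (ℓ , u , ℓ₁ , u₁ , n/ρˡ∈Tᵤ , 1/ρˡ¹∈Tᵤ₁ , refl) (ℓ′ , u′ , ℓ₁′ , u₁′ , ρn/ρˡ′∈Tᵤ′ , 1/ρˡ¹′∈Tᵤ₁′ , refl) =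
  begin
    ℓ′ ℤ.* + μ + (+ u₁′ ℤ.- ℓ₁′ ℤ.* + μ) ℤ.- + u′   ≡⟨ gauge≡difference ℓ′ (+ u′) ℓ₁′ (+ u₁′) (+ μ) ⟩
    weight ℓ′ u′ ℤ.- weight ℓ₁′ u₁′                     ≡⟨ cong₂ ℤ._-_ (weight-invariant ρn/ρˡ′∈Tᵤ′ (InT-ρ* {u = u} n/ρˡ∈Tᵤ))
                                                                       (weight-invariant 1/ρˡ¹′∈Tᵤ₁′ 1/ρˡ¹∈Tᵤ₁) ⟩
    weight (ℓ + + 1) u ℤ.- weight ℓ₁ u₁               ≡⟨ gauge-step ℓ (+ u) ℓ₁ (+ u₁) (+ μ) ⟩
    ℓ ℤ.* + μ + (+ u₁ ℤ.- ℓ₁ ℤ.* + μ) ℤ.- + u + + μ  ∎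
  where
  open ≡-Reasoning
  instance
    ρ≢0 : ℕ.NonZero ρ
    ρ≢0 = ℕ.>-nonZero (ℕP.<-trans ℕ.z<s 2≤ρ)
  open SelfSimilarSet ρ μ K self-similar
  gauge≡difference : ∀ ℓ u ℓ₁ u₁ m → ℓ ℤ.* m + (u₁ ℤ.- ℓ₁ ℤ.* m) ℤ.- u ≡ (ℓ ℤ.* m ℤ.- u) ℤ.- (ℓ₁ ℤ.* m ℤ.- u₁)
  gauge≡difference = ℤ-Solver.solve-∀
  gauge-step : ∀ ℓ u ℓ₁ u₁ m → ((ℓ + + 1) ℤ.* m ℤ.- u) ℤ.- (ℓ₁ ℤ.* m ℤ.- u₁) ≡ ℓ ℤ.* m + (u₁ ℤ.- ℓ₁ ℤ.* m) ℤ.- u + m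
  gauge-step = ℤ-Solver.solve-∀
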